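{- There exists an unrealizable constrained LTLf specification $\mathcal{S}=\langle \mathcal{X}, \mathcal{Y}, \alpha, \varphi \rangle$ such that the LTLf specification $\mathcal{S}_\rightarrow = \langle \mathcal{X}, \mathcal{Y}, \alpha \rightarrow \varphi \rangle$ is realizable.
   Context: Let $\mathcal{X}$ (uncontrollable) and $\mathcal{Y}$ (controllable) be disjoint finite sets of propositional variables. LTL formulas are interpreted over infinite words over $2^{\mathcal{X}\cup\mathcal{Y}}$; LTLf formulas have the same syntax but are interpreted over finite traces. An LTLf specification $\langle \mathcal{X}, \mathcal{Y}, \varphi \rangle$ ($\varphi$ an LTLf formula) is realizable if there is a strategy $\sigma: (2^{\mathcal{X}})^* \rightarrow 2^{\mathcal{Y} \cup \{\mathsf{end}\}}$ that, for every infinite sequence $\mathbf{X}=X_1X_2\ldots$ of subsets of $\mathcal{X}$, outputs $\mathsf{end}$ at exactly one step $n$, such that every induced finite trace $(X_1\cup\sigma(X_1))\cdots(X_n\cup\sigma(X_1\cdots X_n))$ (with $\mathsf{end}$ removed) satisfies $\varphi$ under LTLf semantics. A constrained LTLf specification $\langle \mathcal{X}, \mathcal{Y}, \alpha, \varphi \rangle$ has an LTLf objective $\varphi$ and an LTL assumption $\alpha$ interpreted over infinite traces; strategies output $\mathsf{end}$ at most once per $\mathbf{X}$. Such a strategy is an $\alpha$-strategy if, for every $\mathbf{X}$, either it outputs $\mathsf{end}$ at some finite step or the induced infinite trace $(X_1\cup\sigma(X_1))(X_2\cup\sigma(X_1X_2))\cdots$ does not satisfy $\alpha$; it is winning if it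 is an $\alpha$-strategy and all its induced finite traces satisfy $\varphi$. The constrained specification is realizable if a winning strategy exists. In $\mathcal{S}_\rightarrow$, the formula $\alpha\rightarrow\varphi$ is evaluated entirely under LTLf (finite-trace) semantics. -}

module Defs where

open import Data.Nat using (ℕ; zero; suc; _≤_; _<_; _∸_)
open import Data.Unit using (⊤)
open import Data.Fin using (Fin)
open import Data.Bool using (Bool; true; false; not; _∧_; _∨_)
open import Data.Sum using (_⊎_; inj₁; inj₂)
open import Data.Product using (Σ; ∃; _×_; _,_; proj₁; proj₂)
open import Data.List using (List; []; _∷_; map; upTo; drop; take)
open import Data.Bool.ListAction using (any; all)
open import Data.Empty using (⊥)
open import Relation.Nullary using (¬_)
open import Relation.Binary.PropositionalEquality using (_≡_)

-- Propositional variables: 𝒳 = Fin nx (uncontrollable), 𝒴 = Fin ny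
-- (controllable); the disjoint union is Fin nx ⊎ Fin ny.

Var : ℕ → ℕ → Set
Var nx ny = Fin nx ⊎ Fin ny

Letter : ℕ → ℕ → Set
Letter nx ny = Var nx ny → Bool

InLetter : ℕ → Set
InLetter nx = Fin nx → Bool

OutLetter : ℕ → Set
OutLetter ny = Fin ny → Bool

data Formula (nx ny : ℕ) : Set where
  tt   : Formula nx ny
  atom : Var nx ny → Formula nx ny
  ¬f_  : Formula nx ny → Formula nx ny
  _∧f_ : Formula nx ny → Formula nx ny → Formula nx ny
  _∨f_ : Formula nx ny → Formula nx ny → Formula nx ny
  Xf_  : Formula nx ny → Formula nx ny
  _Uf_ : Formula nx ny → Formula nx ny → Formula nx ny

_⇒f_ : ∀ {nx ny} → Formula nx ny → Formula nx ny → Formula nx ny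
a ⇒f b = (¬f a) ∨f b

_,_⊨∞_ : ∀ {nx ny} → (ℕ → Letter nx ny) → ℕ → Formula nx ny → Set
w , i ⊨∞ tt = ⊤
w , i ⊨∞ atom p = w i p ≡ true
w , i ⊨∞ (¬f φ) = ¬ (w , i ⊨∞ φ)
w , i ⊨∞ (φ ∧f ψ) = (w , i ⊨∞ φ) × (w , i ⊨∞ ψ)
w , i ⊨∞ (φ ∨f ψ) = (w , i ⊨∞ φ) ⊎ (w , i ⊨∞ ψ)
w , i ⊨∞ (Xf φ) = w , suc i ⊨∞ φ
w , i ⊨∞ (φ Uf ψ) =
  ∃ λ k → (i ≤ k) × (w , k ⊨∞ ψ) × (∀ j → i ≤ j → j < k → w , j ⊨∞ φ)

-- LTLf semantics over the finite trace w 0 … w (n-1) (length n),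
-- at position i (meaningful for i < n).  Finite, hence Boolean-valued.

range : ℕ → ℕ → List ℕ
range i n = drop i (upTo n)

satf : ∀ {nx ny} → (n : ℕ) → (ℕ → Letter nx ny) → ℕ → Formula nx ny → Bool
satf n w i tt = true
satf n w i (atom p) = w i p
satf n w i (¬f φ) = not (satf n w i φ)
satf n w i (φ ∧f ψ) = satf n w i φ ∧ satf n w i ψ
satf n w i (φ ∨f ψ) = satf n w i φ ∨ satf n w i ψ
-- X φ : there is a next position (i+1 < n) and φ holds there
satf n w i (Xf φ) = any (λ k → satf n w k φ) (take 1 (range (suc i) n))
-- φ U ψ : some k with i ≤ k < n has ψ, and φ holds at all j with i ≤ j < k
satf n w i (φ Uf ψ) =
  any (λ k → satf n w k ψ ∧ all (λ j → satf n w j φ) (take (k ∸ i) (range i n)))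
      (range i n)

_⊨f_ : ∀ {nx ny} → (ℕ × (ℕ → Letter nx ny)) → Formula nx ny → Set
(n , w) ⊨f φ = satf n w 0 φ ≡ true

-- Strategies σ : (2^𝒳)^* → 2^(𝒴 ∪ {end}); the Bool component is `end`.

Strategy : ℕ → ℕ → Set
Strategy nx ny = List (InLetter nx) → OutLetter ny × Bool

-- infinite input sequence 𝐗 = X₁X₂…, with X_{i+1} = Xs i
InSeq : ℕ → Set
InSeq nx = ℕ → InLetter nx

prefix : ∀ {nx} → InSeq nx → ℕ → List (InLetter nx)
prefix Xs k = map Xs (upTo k)

-- output at position i (= step i+1): σ(X₁ ⋯ X_{i+1})
out : ∀ {nx ny} → Strategy nx ny → InSeq nx → ℕ → OutLetter ny × Bool
out σ Xs i = σ (prefix Xs (suc i))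

endAt : ∀ {nx ny} → Strategy nx ny → InSeq nx → ℕ → Set
endAt σ Xs i = proj₂ (out σ Xs i) ≡ true

induced : ∀ {nx ny} → Strategy nx ny → InSeq nx → ℕ → Letter nx ny
induced σ Xs i (inj₁ x) = Xs i x
induced σ Xs i (inj₂ y) = proj₁ (out σ Xs i) y

Realizable : ∀ {nx ny} → Formula nx ny → Set
Realizable {nx} {ny} φ =
  Σ (Strategy nx ny) λ σ → (Xs : InSeq nx) →
    ∃ λ n → endAt σ Xs n × (∀ m → endAt σ Xs m → m ≡ n)
          × ((suc n , induced σ Xs) ⊨f φ)

AtMostOnceEnd : ∀ {nx ny} → Strategy nx ny → Set
AtMostOnceEnd {nx} σ = (Xs : InSeq nx) → ∀ m m' → endAt σ Xs m → endAt σ Xs m' → m ≡ m'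

-- α-strategy: for every 𝐗, σ outputs end at some step, or the induced
-- infinite trace does not satisfy α.  (Stated as: it is not the case that
-- σ never outputs end and the induced trace satisfies α.)
IsAlphaStrategy : ∀ {nx ny} → Formula nx ny → Strategy nx ny → Set
IsAlphaStrategy {nx} α σ =
  (Xs : InSeq nx) → ¬ ((∀ n → ¬ endAt σ Xs n) × (induced σ Xs , 0 ⊨∞ α))

IsWinning : ∀ {nx ny} → Formula nx ny → Formula nx ny → Strategy nx ny → Set
IsWinning {nx} α φ σ =
  AtMostOnceEnd σ × IsAlphaStrategy α σ
  × ((Xs : InSeq nx) → ∀ n → endAt σ Xs n → (suc n , induced σ Xs) ⊨f φ)

ConstrainedRealizable : ∀ {nx ny} → Formula nx ny → Formula nx ny → Set
ConstrainedRealizable {nx} {ny} α φ = Σ (Strategy nx ny) (IsWinning α φ)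

module Submission where

-- The constrained specification ⟨𝒳, 𝒴, α, φ⟩ and the LTLf specification
-- ⟨𝒳, 𝒴, α → φ⟩ are separated by the two readings of the assumption
--   α = G X true  (written ¬ (true U ¬ X true)).
-- Over infinite traces every position has a successor, so α is LTL-valid;
-- over a nonempty finite trace the last position has none, so α is
-- LTLf-unsatisfiable and ¬ α holds on every nonempty finite trace.
-- Take the objective φ = false.  Then:
--   * A constrained specification whose assumption is LTL-valid and whose
--     objective is unsatisfiable is unrealizable: a winning strategy may
--     never output end (no finite trace satisfies φ), but then the induced
--     infinite trace satisfies α, so it is not an α-strategy.
--   * An LTLf formula that holds on every nonempty finite trace is
--     realizable: output end at the first step.  α → φ is such a formula.

open import Defs
open import Data.Nat using (ℕ; zero; suc; _≤_)
open import Data.Bool using (Bool; true; false; _∧_)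
open import Data.Bool.ListAction using (any; all)
open import Data.Bool.Properties using (∨-zeroʳ)
open import Data.List using (List; []; _∷_; _∷ʳ_; upTo; take; drop)
open import Data.List.Properties using (upTo-∷ʳ; drop-all; length-upTo)
open import Data.Nat.Properties using (≤-refl)
open import Data.Product using (Σ; _×_; _,_)
open import Data.Unit using (tt)
open import Relation.Nullary using (¬_)
open import Relation.Binary.PropositionalEquality using (_≡_; refl; sym; subst)

alwaysNext : ∀ {nx ny} → Formula nx ny
alwaysNext = ¬f (tt Uf (¬f (Xf tt)))

falsum : ∀ {nx ny} → Formula nx ny
falsum = ¬f tt

-- Under LTL semantics G X true holds everywhere: ¬ X true never holds,
-- since every position of an infinite word has a successor.
alwaysNext-valid : ∀ {nx ny} (w : ℕ → Letter nx ny) (i : ℕ) → w , i ⊨∞ alwaysNext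
alwaysNext-valid w i (k , _ , noNext , _) = noNext tt

falsum-unsat : ∀ {nx ny} (n : ℕ) (w : ℕ → Letter nx ny) → ¬ ((n , w) ⊨f falsum)
falsum-unsat n w ()

any-∷ʳ : ∀ {A : Set} (p : A → Bool) (xs : List A) (x : A) →
         p x ≡ true → any p (xs ∷ʳ x) ≡ true
any-∷ʳ p []       x px rewrite px = refl
any-∷ʳ p (y ∷ ys) x px rewrite any-∷ʳ p ys x px = ∨-zeroʳ (p y)

all-true : ∀ {A : Set} (xs : List A) → all (λ _ → true) xs ≡ true
all-true []       = refl
all-true (_ ∷ xs) = all-true xs

-- Under LTLf semantics "true U ¬ X true" (eventually the last position)
-- holds on every nonempty trace: its last position m witnesses it.
eventuallyLast : ∀ {nx ny} (m : ℕ) (w : ℕ → Letter nx ny) →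
                 satf (suc m) w 0 (tt Uf (¬f (Xf tt))) ≡ true
eventuallyLast {nx} {ny} m w =
  subst (λ ks → any witnessAt ks ≡ true) (upTo-∷ʳ m)
        (any-∷ʳ witnessAt (upTo m) m lastWitnesses)
  where
  witnessAt : ℕ → Bool
  witnessAt k = satf (suc m) w k (¬f (Xf (tt {nx} {ny})))
                ∧ all (λ _ → true) (take k (upTo (suc m)))
  noSuccessor : drop (suc m) (upTo (suc m)) ≡ []
  noSuccessor = drop-all (suc m) (upTo (suc m))
                  (subst (_≤ suc m) (sym (length-upTo (suc m))) ≤-refl)
  lastWitnesses : witnessAt m ≡ true
  lastWitnesses rewrite noSuccessor = all-true (take m (upTo (suc m)))

alwaysNext⇒falsum-valid : ∀ {nx ny} (m : ℕ) (w : ℕ → Letter nx ny) →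
                          (suc m , w) ⊨f (alwaysNext ⇒f falsum)
alwaysNext⇒falsum-valid m w rewrite eventuallyLast m w = refl

-- A constrained specification is unrealizable when its assumption is
-- LTL-valid and its objective LTLf-unsatisfiable: on the all-false input,
-- a winning strategy can never output end, so the induced infinite trace
-- satisfies α and the strategy is not an α-strategy.
unrealizable-of-valid-assumption :
  ∀ {nx ny} {α φ : Formula nx ny} →
  (∀ w → w , 0 ⊨∞ α) → (∀ n w → ¬ ((n , w) ⊨f φ)) → ¬ ConstrainedRealizable α φ
unrealizable-of-valid-assumption {nx} valid unsat (σ , _ , isAlpha , wins) =
  isAlpha silent (neverEnds , valid (induced σ silent))
  where
  silent : InSeq nx
  silent _ _ = false
  neverEnds : ∀ n → ¬ endAt σ silent n
  neverEnds n endsAt = unsat (suc n) (induced σ silent) (wins silent n endsAt)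

endFirst : ∀ {nx ny} → Strategy nx ny
endFirst (_ ∷ []) = (λ _ → false) , true
endFirst _        = (λ _ → false) , false

endFirst-endsOnlyAt0 : ∀ {nx ny} (Xs : InSeq nx) (m : ℕ) →
                       endAt (endFirst {ny = ny}) Xs m → m ≡ 0
endFirst-endsOnlyAt0 Xs zero    _ = refl
endFirst-endsOnlyAt0 Xs (suc m) ()

-- An LTLf formula holding on every nonempty finite trace is realizable,
-- by ending immediately.
realizable-of-valid : ∀ {nx ny} {ψ : Formula nx ny} →
                      (∀ m w → (suc m , w) ⊨f ψ) → Realizable ψ
realizable-of-valid valid =
  endFirst , λ Xs → 0 , refl , endFirst-endsOnlyAt0 Xs , valid 0 (induced endFirst Xs)

theorem2 : Σ ℕ λ nx → Σ ℕ λ ny → Σ (Formula nx ny) λ α → Σ (Formula nx ny) λ φ →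
    ¬ ConstrainedRealizable α φ × Realizable (α ⇒f φ)
theorem2 =
  0 , 0 , alwaysNext , falsum
  , unrealizable-of-valid-assumption {α = alwaysNext} {φ = falsum}
      (λ w → alwaysNext-valid w 0) falsum-unsat
  , realizable-of-valid {ψ = alwaysNext ⇒f falsum} alwaysNext⇒falsum-valid
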